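{- For integers $n \geq 1$ define \[ \mathbf{F}_n(x) = \sum_{\nu=1}^n \nu!\,\mathbf{S}_2(n,\nu)\, x^\nu, \qquad \widehat{\mathbf{F}}_n(x) = \sum_{\nu=1}^n \nu!\,\mathbf{S}_2(n,\nu)\, \mathbf{H}_\nu\, x^\nu. \] Define polynomials $\lambda_{n,\nu}(x)$ for integers $n \geq 1$ and $\nu$ by: $\lambda_{1,1}(x) = 1$; $\lambda_{n,\nu}(x) = 0$ if $\nu < 1$ or $\nu > n$; and otherwise recursively \[ \lambda_{n+1,\nu}(x) = (x^2+x)\,\lambda_{n,\nu}'(x) + \lambda_{n,\nu-1}(x) + x\,\delta_{n,\nu}, \] where $\delta$ is the Kronecker delta. Then for all $n \geq 1$, \[ \widehat{\mathbf{F}}_n(x) = \sum_{\nu=1}^n \lambda_{n,\nu}(x)\,\mathbf{F}_\nu(x). \] Furthermore, each $\lambda_{n,\nu}$ has nonnegative integer coefficients, $\deg \lambda_{n,\nu} = n-\nu$ for $\nu = 1,\ldots,n$, and $\lambda_{n,n-1}(x) = (n-1)x$.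
   Context: $\mathbf{S}_2(n,k)$ denotes the Stirling numbers of the second kind. $\mathbf{H}_\nu = \sum_{j=1}^\nu 1/j$ is the $\nu$-th harmonic number. -}

module Defs where

open import Data.Nat as ℕ using (ℕ; zero; suc; _∸_; _≡ᵇ_; _≤ᵇ_; _!)
open import Relation.Binary.PropositionalEquality using (_≡_; _≢_)
open import Data.Product using (_×_)
open import Data.Integer using (+_)
open import Data.Rational using (ℚ; 0ℚ; 1ℚ; _+_; _*_; _/_)
open import Data.Bool using (if_then_else_)

toℚ : ℕ → ℚ
toℚ m = (+ m) / 1

S₂ : ℕ → ℕ → ℕ
S₂ zero zero = 1
S₂ zero (suc k) = 0
S₂ (suc n) zero = 0
S₂ (suc n) (suc k) = suc k ℕ.* S₂ n (suc k) ℕ.+ S₂ n k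

H : ℕ → ℚ
H zero = 0ℚ
H (suc ν) = H ν + ((+ 1) / suc ν)

-- polynomials over ℚ, represented by their coefficient sequence
-- (p k = coefficient of x^k); all polynomials below have finite support.
Poly : Set
Poly = ℕ → ℚ

0P : Poly
0P _ = 0ℚ

infixl 6 _+P_
_+P_ : Poly → Poly → Poly
(p +P q) k = p k + q k

monomial : ℚ → ℕ → Poly
monomial c ν k = if k ≡ᵇ ν then c else 0ℚ

mulX : Poly → Poly
mulX p zero = 0ℚ
mulX p (suc k) = p k

mulX²+X : Poly → Poly
mulX²+X p k = mulX (mulX p) k + mulX p k

deriv : Poly → Poly
deriv p k = toℚ (suc k) * p (suc k)

convAux : Poly → Poly → ℕ → ℕ → ℚ
convAux p q k zero = p 0 * q k
convAux p q k (suc i) = p (suc i) * q (k ∸ suc i) + convAux p q k i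

_*P_ : Poly → Poly → Poly
(p *P q) k = convAux p q k k

sum1 : ℕ → (ℕ → Poly) → Poly
sum1 zero f = 0P
sum1 (suc n) f = sum1 n f +P f (suc n)

F : ℕ → Poly
F n = sum1 n (λ ν → monomial (toℚ ((ν !) ℕ.* S₂ n ν)) ν)

Fhat : ℕ → Poly
Fhat n = sum1 n (λ ν → monomial (toℚ ((ν !) ℕ.* S₂ n ν) * H ν) ν)

-- λ_{n,ν}(x), meaningful for n ≥ 1 (λ_{0,ν} := 0 is an unused convention).
-- ν ranges over ℕ; ν = 0 (and, implicitly, all negative ν) give 0.
lam : ℕ → ℕ → Poly
lam zero ν = 0P
lam (suc zero) ν = if ν ≡ᵇ 1 then monomial 1ℚ 0 else 0P
lam (suc (suc m)) zero = 0P
lam (suc (suc m)) (suc μ) =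
  if suc (suc m) ≤ᵇ μ then 0P            -- ν > n+1  (here n = m+1, ν = μ+1)
  else (mulX²+X (deriv (lam (suc m) (suc μ)))
        +P lam (suc m) μ
        +P (if suc m ≡ᵇ suc μ then mulX (monomial 1ℚ 0) else 0P))

HasDegree : Poly → ℕ → Set
HasDegree p d = (p d ≢ 0ℚ) × (∀ k → d ℕ.< k → p k ≡ 0ℚ)

module Submission where

-- Let θ = x d/dx, D = (x²+x) d/dx = (1+x)θ and L p = D p + x p.  Since θ and
-- D are derivations of the polynomial ring, L obeys L(λ·f) = Dλ·f + λ·Lf.
-- The coefficients c_{n,k} = k! S₂(n,k) of F_n satisfy
-- c_{n+1,j+1} = (j+1)(c_{n,j} + c_{n,j+1}), and together with
-- (j+1) H_{j+1} = (j+1) H_j + 1 this gives the recurrences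
--     F_{n+1} = L F_n,        F̂_{n+1} = L F̂_n + x F_n.
-- Expanding λ_{n+1,ν} by its defining recursion and applying the Leibniz
-- rule shows that G_n = Σ_ν λ_{n,ν} F_ν satisfies the recurrence of F̂_n;
-- as F̂_1 = G_1 = x, the identity follows by induction on n.
-- For the other claims the recursion of λ is replayed on polynomials with
-- coefficients in ℕ (lamN): λ_{n,ν} is the image of lamN n ν in ℚ, which
-- gives integrality, and degrees and the sub-diagonal are computed in ℕ,
-- where a sum of coefficients is nonzero as soon as one summand is.

open import Defs
open import Data.Nat as ℕ using (ℕ; zero; suc; _∸_; _≤_; _<_; z≤n; s≤s; _!)
import Data.Nat.Properties as NP
import Data.Nat.Coprimality as NC
open import Data.Nat.Solver using () renaming (module +-*-Solver to ℕ-Solver)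
import Data.Integer as ℤ
import Data.Integer.Properties as ZP
open import Data.Rational using (ℚ; 0ℚ; 1ℚ; mkℚ; _+_; _*_; _/_)
import Data.Rational.Properties as QP
open import Data.Rational.Solver using () renaming (module +-*-Solver to ℚ-Solver)
open import Data.Bool using (true; false; if_then_else_; T)
open import Data.Bool.Properties using (if-float)
open import Data.Unit using (tt)
open import Data.Empty using (⊥-elim)
open import Data.Product using (_×_; _,_; ∃; proj₁; proj₂)
open import Data.Sum using (inj₁; inj₂)
open import Relation.Binary.Bundles using (Setoid)
open import Relation.Binary.PropositionalEquality
import Relation.Binary.Reasoning.Setoid as SetoidReasoning

toℚ-normal : ∀ m → toℚ m ≡ mkℚ (ℤ.+ m) 0 (NC.sym (NC.1-coprimeTo m))
toℚ-normal m = QP.normalize-coprime (NC.sym (NC.1-coprimeTo m))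

toℚ-+ : ∀ a b → toℚ (a ℕ.+ b) ≡ toℚ a + toℚ b
toℚ-+ a b rewrite toℚ-normal a | toℚ-normal b =
  cong (_/ 1) (trans (ZP.pos-+ a b)
    (sym (cong₂ ℤ._+_ (ZP.*-identityʳ (ℤ.+ a)) (ZP.*-identityʳ (ℤ.+ b)))))

toℚ-* : ∀ a b → toℚ (a ℕ.* b) ≡ toℚ a * toℚ b
toℚ-* a b rewrite toℚ-normal a | toℚ-normal b = cong (_/ 1) (ZP.pos-* a b)

toℚ-injective-0 : ∀ m → toℚ m ≡ 0ℚ → m ≡ 0
toℚ-injective-0 m e with trans (sym (toℚ-normal m)) e
... | refl = refl

toℚ-suc-inverse : ∀ ν → toℚ (suc ν) * ((ℤ.+ 1) / suc ν) ≡ 1ℚ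
toℚ-suc-inverse ν rewrite toℚ-normal (suc ν) | QP.normalize-coprime {1} {ν} (NC.1-coprimeTo (suc ν)) =
  QP.*-inverseʳ (mkℚ (ℤ.+ suc ν) 0 (NC.sym (NC.1-coprimeTo (suc ν))))

≡ᵇ-refl : ∀ n → (n ℕ.≡ᵇ n) ≡ true
≡ᵇ-refl zero = refl
≡ᵇ-refl (suc n) = ≡ᵇ-refl n

≡ᵇ-≢ : ∀ m n → m ≢ n → (m ℕ.≡ᵇ n) ≡ false
≡ᵇ-≢ m n m≢n with m ℕ.≡ᵇ n in eq
... | false = refl
... | true = ⊥-elim (m≢n (NP.≡ᵇ⇒≡ m n (subst T (sym eq) tt)))

≤ᵇ-≤ : ∀ {m n} → m ≤ n → (m ℕ.≤ᵇ n) ≡ true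
≤ᵇ-≤ {m} {n} m≤n with m ℕ.≤ᵇ n in eq
... | true = refl
... | false = ⊥-elim (subst T eq (NP.≤⇒≤ᵇ m≤n))

≤ᵇ-> : ∀ {m n} → n < m → (m ℕ.≤ᵇ n) ≡ false
≤ᵇ-> {m} {n} n<m with m ℕ.≤ᵇ n in eq
... | false = refl
... | true = ⊥-elim (NP.<⇒≱ n<m (NP.≤ᵇ⇒≤ m n (subst T (sym eq) tt)))

if-true : ∀ {A : Set} {b} {x y : A} → b ≡ true → (if b then x else y) ≡ x
if-true refl = refl

if-false : ∀ {A : Set} {b} {x y : A} → b ≡ false → (if b then x else y) ≡ y
if-false refl = refl

Poly-setoid : Setoid _ _
Poly-setoid = ℕ →-setoid ℚ

open Setoid Poly-setoid using () renaming (refl to ≗-refl; sym to ≗-sym; trans to ≗-trans)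

+P-cong : ∀ {p p′ q q′} → p ≗ p′ → q ≗ q′ → p +P q ≗ p′ +P q′
+P-cong e f k = cong₂ _+_ (e k) (f k)

mulX-cong : ∀ {p q} → p ≗ q → mulX p ≗ mulX q
mulX-cong e zero = refl
mulX-cong e (suc k) = e k

mulX-+ : ∀ p q → mulX (p +P q) ≗ mulX p +P mulX q
mulX-+ p q zero = refl
mulX-+ p q (suc k) = refl

mulX-zero : ∀ {p} → p ≗ 0P → mulX p ≗ 0P
mulX-zero e zero = refl
mulX-zero e (suc k) = e k

monomial-on : ∀ c k → monomial c k k ≡ c
monomial-on c k rewrite ≡ᵇ-refl k = refl

monomial-off : ∀ c ν k → k ≢ ν → monomial c ν k ≡ 0ℚ
monomial-off c ν k k≢ν rewrite ≡ᵇ-≢ k ν k≢ν = refl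

swap-middle : ∀ a b c d → (a + b) + (c + d) ≡ (a + c) + (b + d)
swap-middle = solve 4 (λ a b c d → (a :+ b) :+ (c :+ d) := (a :+ c) :+ (b :+ d)) refl
  where open ℚ-Solver

-- The operators θ = x d/dx, D = (x²+x) d/dx and L = D + x

θ : Poly → Poly
θ p k = toℚ k * p k

D : Poly → Poly
D p = mulX²+X (deriv p)

L : Poly → Poly
L p = D p +P mulX p

θ-zero : ∀ {p} → p ≗ 0P → θ p ≗ 0P
θ-zero e k = trans (cong (toℚ k *_) (e k)) (QP.*-zeroʳ (toℚ k))

mulX-deriv : ∀ p → mulX (deriv p) ≗ θ p
mulX-deriv p zero = sym (QP.*-zeroˡ (p 0))
mulX-deriv p (suc k) = refl

D-θ : ∀ p → D p ≗ mulX (θ p) +P θ p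
D-θ p = +P-cong (mulX-cong (mulX-deriv p)) (mulX-deriv p)

D-cong : ∀ {p q} → p ≗ q → D p ≗ D q
D-cong {p} {q} e = ≗-trans (D-θ p) (≗-trans (+P-cong (mulX-cong θe) θe) (≗-sym (D-θ q)))
  where
  θe : θ p ≗ θ q
  θe k = cong (toℚ k *_) (e k)

D-zero : ∀ {p} → p ≗ 0P → D p ≗ 0P
D-zero {p} e k = trans (D-θ p k) (cong₂ _+_ (mulX-zero (θ-zero e) k) (θ-zero e k))

L-cong : ∀ {p q} → p ≗ q → L p ≗ L q
L-cong e = +P-cong (D-cong e) (mulX-cong e)

L-coeff-suc : ∀ p j → L p (suc j) ≡ toℚ (suc j) * (p j + p (suc j))
L-coeff-suc p j = begin
    (mulX (deriv p) j + deriv p j) + p j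
  ≡⟨ cong (λ z → (z + deriv p j) + p j) (mulX-deriv p j) ⟩
    (toℚ j * p j + toℚ (suc j) * p (suc j)) + p j
  ≡⟨ cong (λ t → (toℚ j * p j + t * p (suc j)) + p j) (toℚ-+ 1 j) ⟩
    (toℚ j * p j + (1ℚ + toℚ j) * p (suc j)) + p j
  ≡⟨ solve 3 (λ t a b → (t :* a :+ (con 1ℚ :+ t) :* b) :+ a := (con 1ℚ :+ t) :* (a :+ b))
       refl (toℚ j) (p j) (p (suc j)) ⟩
    (1ℚ + toℚ j) * (p j + p (suc j))
  ≡⟨ cong (_* (p j + p (suc j))) (sym (toℚ-+ 1 j)) ⟩
    toℚ (suc j) * (p j + p (suc j))
  ∎
  where
  open ≡-Reasoning
  open ℚ-Solver

L-+ : ∀ p q → L (p +P q) ≗ L p +P L q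
L-+ p q zero = refl
L-+ p q (suc j) = begin
    L (p +P q) (suc j)
  ≡⟨ L-coeff-suc (p +P q) j ⟩
    t * ((p j + q j) + (p (suc j) + q (suc j)))
  ≡⟨ solve 5 (λ t a b c d → t :* ((a :+ b) :+ (c :+ d)) := t :* (a :+ c) :+ t :* (b :+ d))
       refl t (p j) (q j) (p (suc j)) (q (suc j)) ⟩
    t * (p j + p (suc j)) + t * (q j + q (suc j))
  ≡⟨ sym (cong₂ _+_ (L-coeff-suc p j) (L-coeff-suc q j)) ⟩
    L p (suc j) + L q (suc j)
  ∎
  where
  open ≡-Reasoning
  open ℚ-Solver
  t = toℚ (suc j)

L-0P : L 0P ≗ 0P
L-0P zero = refl
L-0P (suc j) = trans (L-coeff-suc 0P j) (QP.*-zeroʳ (toℚ (suc j)))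

*P-cong : ∀ {p p′ q q′} → p ≗ p′ → q ≗ q′ → p *P q ≗ p′ *P q′
*P-cong {p} {p′} {q} {q′} e f k = go k
  where
  go : ∀ i → convAux p q k i ≡ convAux p′ q′ k i
  go zero = cong₂ _*_ (e 0) (f k)
  go (suc i) = cong₂ _+_ (cong₂ _*_ (e (suc i)) (f (k ∸ suc i))) (go i)

*P-distribʳ : ∀ p q r → (p +P q) *P r ≗ p *P r +P q *P r
*P-distribʳ p q r k = go k
  where
  go : ∀ i → convAux (p +P q) r k i ≡ convAux p r k i + convAux q r k i
  go zero = QP.*-distribʳ-+ (r k) (p 0) (q 0)
  go (suc i) = trans (cong₂ _+_ (QP.*-distribʳ-+ (r (k ∸ suc i)) (p (suc i)) (q (suc i))) (go i))
    (swap-middle (p (suc i) * r (k ∸ suc i)) (q (suc i) * r (k ∸ suc i)) (convAux p r k i) (convAux q r k i))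

*P-distribˡ : ∀ p q r → p *P (q +P r) ≗ p *P q +P p *P r
*P-distribˡ p q r k = go k
  where
  go : ∀ i → convAux p (q +P r) k i ≡ convAux p q k i + convAux p r k i
  go zero = QP.*-distribˡ-+ (p 0) (q k) (r k)
  go (suc i) = trans (cong₂ _+_ (QP.*-distribˡ-+ (p (suc i)) (q (k ∸ suc i)) (r (k ∸ suc i))) (go i))
    (swap-middle (p (suc i) * q (k ∸ suc i)) (p (suc i) * r (k ∸ suc i)) (convAux p q k i) (convAux p r k i))

*P-zeroˡ : ∀ {p} q → p ≗ 0P → p *P q ≗ 0P
*P-zeroˡ {p} q e k = go k
  where
  go : ∀ i → convAux p q k i ≡ 0ℚ
  go zero = trans (cong (_* q k) (e 0)) (QP.*-zeroˡ (q k))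
  go (suc i) = cong₂ _+_ (trans (cong (_* q (k ∸ suc i)) (e (suc i))) (QP.*-zeroˡ (q (k ∸ suc i)))) (go i)

*P-identityˡ : ∀ q → monomial 1ℚ 0 *P q ≗ q
*P-identityˡ q k = go k
  where
  go : ∀ i → convAux (monomial 1ℚ 0) q k i ≡ q k
  go zero = QP.*-identityˡ (q k)
  go (suc i) = trans (cong₂ _+_ (QP.*-zeroˡ (q (k ∸ suc i))) (go i)) (QP.+-identityˡ (q k))

*P-mulXˡ : ∀ p q → mulX p *P q ≗ mulX (p *P q)
*P-mulXˡ p q zero = QP.*-zeroˡ (q 0)
*P-mulXˡ p q (suc k) = go k
  where
  go : ∀ i → convAux (mulX p) q (suc k) (suc i) ≡ convAux p q k i
  go zero = trans (cong (λ z → p 0 * q k + z) (QP.*-zeroˡ (q (suc k)))) (QP.+-identityʳ _)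
  go (suc i) = cong (λ z → p (suc i) * q (k ∸ suc i) + z) (go i)

*P-mulXʳ : ∀ p q → p *P mulX q ≗ mulX (p *P q)
*P-mulXʳ p q zero = QP.*-zeroʳ (p 0)
*P-mulXʳ p q (suc k) rewrite NP.n∸n≡0 k =
  trans (cong₂ _+_ (QP.*-zeroʳ (p (suc k))) (go k NP.≤-refl)) (QP.+-identityˡ _)
  where
  go : ∀ i → i ≤ k → convAux p (mulX q) (suc k) i ≡ convAux p q k i
  go zero i≤k = refl
  go (suc i) i<k rewrite NP.+-∸-assoc 1 i<k = cong (λ z → p (suc i) * q (k ∸ suc i) + z) (go i (NP.<⇒≤ i<k))

-- θ is a derivation: the coefficient of x^k in a product splits as k = i + (k - i).
θ-Leibniz : ∀ p q → θ (p *P q) ≗ θ p *P q +P p *P θ q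
θ-Leibniz p q k = go k NP.≤-refl
  where
  open ℚ-Solver
  term : ∀ i → i ≤ k →
    toℚ k * (p i * q (k ∸ i)) ≡ (toℚ i * p i) * q (k ∸ i) + p i * (toℚ (k ∸ i) * q (k ∸ i))
  term i i≤k rewrite trans (cong toℚ (sym (NP.m+[n∸m]≡n i≤k))) (toℚ-+ i (k ∸ i)) =
    solve 4 (λ a b c d → (a :+ b) :* (c :* d) := (a :* c) :* d :+ c :* (b :* d))
      refl (toℚ i) (toℚ (k ∸ i)) (p i) (q (k ∸ i))
  go : ∀ i → i ≤ k → toℚ k * convAux p q k i ≡ convAux (θ p) q k i + convAux p (θ q) k i
  go zero i≤k = term 0 i≤k
  go (suc i) i<k = trans (QP.*-distribˡ-+ (toℚ k) _ _)
    (trans (cong₂ _+_ (term (suc i) i<k) (go i (NP.<⇒≤ i<k)))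
      (swap-middle ((toℚ (suc i) * p (suc i)) * q (k ∸ suc i)) (p (suc i) * (toℚ (k ∸ suc i) * q (k ∸ suc i)))
        (convAux (θ p) q k i) (convAux p (θ q) k i)))

-- D = (1+x)θ is a derivation as well.
D-Leibniz : ∀ p q → D (p *P q) ≗ D p *P q +P p *P D q
D-Leibniz p q k = begin
    D (p *P q) k
  ≡⟨ D-θ (p *P q) k ⟩
    mulX (θ (p *P q)) k + θ (p *P q) k
  ≡⟨ cong₂ _+_ (trans (mulX-cong (θ-Leibniz p q) k) (mulX-+ (θ p *P q) (p *P θ q) k)) (θ-Leibniz p q k) ⟩
    (mulX (θ p *P q) k + mulX (p *P θ q) k) + (b + d)
  ≡⟨ sym (cong₂ (λ x y → (x + y) + (b + d)) (*P-mulXˡ (θ p) q k) (*P-mulXʳ p (θ q) k)) ⟩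
    (a + c) + (b + d)
  ≡⟨ swap-middle a c b d ⟩
    (a + b) + (c + d)
  ≡⟨ sym (cong₂ _+_ (*P-distribʳ (mulX (θ p)) (θ p) q k) (*P-distribˡ p (mulX (θ q)) (θ q) k)) ⟩
    ((mulX (θ p) +P θ p) *P q) k + (p *P (mulX (θ q) +P θ q)) k
  ≡⟨ sym (cong₂ _+_ (*P-cong (D-θ p) ≗-refl k) (*P-cong ≗-refl (D-θ q) k)) ⟩
    (D p *P q) k + (p *P D q) k
  ∎
  where
  open ≡-Reasoning
  a = (mulX (θ p) *P q) k
  b = (θ p *P q) k
  c = (p *P mulX (θ q)) k
  d = (p *P θ q) k

L-Leibniz : ∀ p q → L (p *P q) ≗ D p *P q +P p *P L q
L-Leibniz p q k = begin
    D (p *P q) k + mulX (p *P q) k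
  ≡⟨ cong₂ _+_ (D-Leibniz p q k) (sym (*P-mulXʳ p q k)) ⟩
    ((D p *P q) k + (p *P D q) k) + (p *P mulX q) k
  ≡⟨ QP.+-assoc ((D p *P q) k) ((p *P D q) k) ((p *P mulX q) k) ⟩
    (D p *P q) k + ((p *P D q) k + (p *P mulX q) k)
  ≡⟨ cong (λ z → (D p *P q) k + z) (sym (*P-distribˡ p (D q) (mulX q) k)) ⟩
    (D p *P q) k + (p *P L q) k
  ∎
  where open ≡-Reasoning

sum1-cong : ∀ n {f g} → (∀ ν → 1 ≤ ν → ν ≤ n → f ν ≗ g ν) → sum1 n f ≗ sum1 n g
sum1-cong zero e = ≗-refl
sum1-cong (suc n) e =
  +P-cong (sum1-cong n (λ ν 1≤ν ν≤n → e ν 1≤ν (NP.m≤n⇒m≤1+n ν≤n))) (e (suc n) (s≤s z≤n) NP.≤-refl)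

sum1-+ : ∀ n f g → sum1 n (λ ν → f ν +P g ν) ≗ sum1 n f +P sum1 n g
sum1-+ zero f g k = refl
sum1-+ (suc n) f g k = trans (cong (_+ (f (suc n) k + g (suc n) k)) (sum1-+ n f g k))
  (swap-middle (sum1 n f k) (sum1 n g k) (f (suc n) k) (g (suc n) k))

sum1-zero : ∀ n {f} k → (∀ ν → 1 ≤ ν → ν ≤ n → f ν k ≡ 0ℚ) → sum1 n f k ≡ 0ℚ
sum1-zero zero k z = refl
sum1-zero (suc n) k z =
  cong₂ _+_ (sum1-zero n k (λ ν 1≤ν ν≤n → z ν 1≤ν (NP.m≤n⇒m≤1+n ν≤n))) (z (suc n) (s≤s z≤n) NP.≤-refl)

sum1-single : ∀ N n {f} k → 1 ≤ n → n ≤ N → (∀ ν → ν ≢ n → f ν k ≡ 0ℚ) → sum1 N f k ≡ f n k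
sum1-single zero (suc n) k _ () _
sum1-single (suc N) n {f} k 1≤n n≤1+N off with NP.m≤n⇒m<n∨m≡n n≤1+N
... | inj₂ refl = trans (cong (_+ f (suc N) k)
                           (sum1-zero N k (λ ν _ ν≤N → off ν (NP.<⇒≢ (s≤s ν≤N)))))
                        (QP.+-identityˡ _)
... | inj₁ (s≤s n≤N) = trans (cong₂ _+_ (sum1-single N n k 1≤n n≤N off)
                                        (off (suc N) (λ e → NP.<⇒≢ (s≤s n≤N) (sym e))))
                             (QP.+-identityʳ _)

sum1-shift : ∀ n f → sum1 (suc n) f ≗ f 1 +P sum1 n (λ ν → f (suc ν))
sum1-shift zero f k = trans (QP.+-identityˡ (f 1 k)) (sym (QP.+-identityʳ (f 1 k)))
sum1-shift (suc n) f k = trans (cong (_+ f (suc (suc n)) k) (sum1-shift n f k)) (QP.+-assoc (f 1 k) _ _)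

L-sum : ∀ n f → L (sum1 n f) ≗ sum1 n (λ ν → L (f ν))
L-sum zero f = L-0P
L-sum (suc n) f = ≗-trans (L-+ (sum1 n f) (f (suc n))) (+P-cong (L-sum n f) ≗-refl)

monomial-sum : ∀ n (c : ℕ → ℚ) → c 0 ≡ 0ℚ → (∀ k → n < k → c k ≡ 0ℚ) →
  sum1 n (λ ν → monomial (c ν) ν) ≗ c
monomial-sum n c c0 c-above zero = trans (sum1-zero n 0 (λ { (suc ν) _ _ → refl })) (sym c0)
monomial-sum n c c0 c-above (suc k) with NP.≤-<-connex (suc k) n
... | inj₁ k≤n = trans (sum1-single n (suc k) (suc k) (s≤s z≤n) k≤n
                          (λ ν ν≢k → monomial-off (c ν) ν (suc k) (λ e → ν≢k (sym e))))
                       (monomial-on (c (suc k)) (suc k))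
... | inj₂ n<k = trans (sum1-zero n (suc k)
                          (λ ν _ ν≤n → monomial-off (c ν) ν (suc k) (λ e → NP.<⇒≢ (NP.≤-<-trans ν≤n n<k) (sym e))))
                       (sym (c-above (suc k) n<k))

-- The recurrences F_{n+1} = L F_n and F̂_{n+1} = L F̂_n + x F_n

coeff : ℕ → ℕ → ℕ
coeff n k = (k !) ℕ.* S₂ n k

S₂-above : ∀ n k → n < k → S₂ n k ≡ 0
S₂-above zero (suc k) _ = refl
S₂-above (suc n) (suc k) (s≤s n<k)
  rewrite S₂-above n (suc k) (NP.m<n⇒m<1+n n<k) | S₂-above n k n<k = trans (NP.+-identityʳ _) (NP.*-zeroʳ k)

coeff-above : ∀ n k → n < k → coeff n k ≡ 0
coeff-above n k n<k rewrite S₂-above n k n<k = NP.*-zeroʳ (k !)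

-- The Stirling recurrence, multiplied by (j+1)!.
coeff-rec : ∀ n j → coeff (suc n) (suc j) ≡ suc j ℕ.* (coeff n j ℕ.+ coeff n (suc j))
coeff-rec n j = ℕ-Solver.solve 4
  (λ j f a b → ((con 1 :+ j) :* f) :* ((con 1 :+ j) :* b :+ a)
           := (con 1 :+ j) :* (f :* a :+ ((con 1 :+ j) :* f) :* b))
  refl j (j !) (S₂ n j) (S₂ n (suc j))
  where open ℕ-Solver

coeffℚ-rec : ∀ n j →
  toℚ (coeff (suc n) (suc j)) ≡ toℚ (suc j) * (toℚ (coeff n j) + toℚ (coeff n (suc j)))
coeffℚ-rec n j = trans (cong toℚ (coeff-rec n j))
  (trans (toℚ-* (suc j) (coeff n j ℕ.+ coeff n (suc j))) (cong (toℚ (suc j) *_) (toℚ-+ (coeff n j) (coeff n (suc j)))))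

F-coeff : ∀ n → 1 ≤ n → F n ≗ (λ k → toℚ (coeff n k))
F-coeff (suc n) _ = monomial-sum (suc n) _ refl (λ k n<k → cong toℚ (coeff-above (suc n) k n<k))

Fhat-coeff : ∀ n → 1 ≤ n → Fhat n ≗ (λ k → toℚ (coeff n k) * H k)
Fhat-coeff (suc n) _ = monomial-sum (suc n) _ refl
  (λ k n<k → trans (cong (λ c → toℚ c * H k) (coeff-above (suc n) k n<k)) (QP.*-zeroˡ (H k)))

F-rec : ∀ n → 1 ≤ n → F (suc n) ≗ L (F n)
F-rec n 1≤n zero = F-coeff (suc n) (s≤s z≤n) zero
F-rec n 1≤n (suc j) = begin
    F (suc n) (suc j)
  ≡⟨ F-coeff (suc n) (s≤s z≤n) (suc j) ⟩
    toℚ (coeff (suc n) (suc j))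
  ≡⟨ coeffℚ-rec n j ⟩
    toℚ (suc j) * (toℚ (coeff n j) + toℚ (coeff n (suc j)))
  ≡⟨ sym (cong (toℚ (suc j) *_) (cong₂ _+_ (F-coeff n 1≤n j) (F-coeff n 1≤n (suc j)))) ⟩
    toℚ (suc j) * (F n j + F n (suc j))
  ≡⟨ sym (L-coeff-suc (F n) j) ⟩
    L (F n) (suc j)
  ∎
  where open ≡-Reasoning

-- With t = j+1 and H_{j+1} = H_j + 1/t:  t(a+b)H_{j+1} = t(a H_j + b H_{j+1}) + a.
Fhat-rec : ∀ n → 1 ≤ n → Fhat (suc n) ≗ L (Fhat n) +P mulX (F n)
Fhat-rec n 1≤n zero = Fhat-coeff (suc n) (s≤s z≤n) zero
Fhat-rec n 1≤n (suc j) = begin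
    Fhat (suc n) (suc j)
  ≡⟨ Fhat-coeff (suc n) (s≤s z≤n) (suc j) ⟩
    toℚ (coeff (suc n) (suc j)) * (h + r)
  ≡⟨ cong (_* (h + r)) (coeffℚ-rec n j) ⟩
    (t * (a + b)) * (h + r)
  ≡⟨ solve 5 (λ t a b h r → (t :* (a :+ b)) :* (h :+ r) := t :* (a :* h :+ b :* (h :+ r)) :+ a :* (t :* r))
       refl t a b h r ⟩
    t * (a * h + b * (h + r)) + a * (t * r)
  ≡⟨ cong (λ z → t * (a * h + b * (h + r)) + a * z) (toℚ-suc-inverse j) ⟩
    t * (a * h + b * (h + r)) + a * 1ℚ
  ≡⟨ cong₂ _+_ (cong (t *_) (sym (cong₂ _+_ (Fhat-coeff n 1≤n j) (Fhat-coeff n 1≤n (suc j)))))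
               (trans (QP.*-identityʳ a) (sym (F-coeff n 1≤n j))) ⟩
    t * (Fhat n j + Fhat n (suc j)) + F n j
  ≡⟨ cong (_+ F n j) (sym (L-coeff-suc (Fhat n) j)) ⟩
    L (Fhat n) (suc j) + mulX (F n) (suc j)
  ∎
  where
  open ≡-Reasoning
  open ℚ-Solver
  t = toℚ (suc j)
  a = toℚ (coeff n j)
  b = toℚ (coeff n (suc j))
  h = H j
  r = (ℤ.+ 1) / suc j

xδ : ℕ → ℕ → Poly
xδ n ν = if n ℕ.≡ᵇ ν then mulX (monomial 1ℚ 0) else 0P

lam-step : ∀ m μ → μ ≤ suc m →
  lam (suc (suc m)) (suc μ) ≗ (D (lam (suc m) (suc μ)) +P lam (suc m) μ) +P xδ (suc m) (suc μ)
lam-step m μ μ≤1+m k =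
  cong (λ p → p k) (if-false {x = 0P} {y = (D (lam (suc m) (suc μ)) +P lam (suc m) μ) +P xδ (suc m) (suc μ)}
    (≤ᵇ-> (s≤s μ≤1+m)))

-- The recursion of λ over ℕ

PolyN : Set
PolyN = ℕ → ℕ

embed : PolyN → Poly
embed p k = toℚ (p k)

0N : PolyN
0N _ = 0

infixl 6 _+N_
_+N_ : PolyN → PolyN → PolyN
(p +N q) k = p k ℕ.+ q k

monoN : ℕ → ℕ → PolyN
monoN c d k = if k ℕ.≡ᵇ d then c else 0

mulXN : PolyN → PolyN
mulXN p zero = 0
mulXN p (suc k) = p k

derivN : PolyN → PolyN
derivN p k = suc k ℕ.* p (suc k)

mulX²+XN : PolyN → PolyN
mulX²+XN p k = mulXN (mulXN p) k ℕ.+ mulXN p k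

DN : PolyN → PolyN
DN p = mulX²+XN (derivN p)

xδN : ℕ → ℕ → PolyN
xδN n ν = if n ℕ.≡ᵇ ν then mulXN (monoN 1 0) else 0N

lamN : ℕ → ℕ → PolyN
lamN zero ν = 0N
lamN (suc zero) ν = if ν ℕ.≡ᵇ 1 then monoN 1 0 else 0N
lamN (suc (suc m)) zero = 0N
lamN (suc (suc m)) (suc μ) =
  if suc (suc m) ℕ.≤ᵇ μ then 0N
  else (DN (lamN (suc m) (suc μ)) +N lamN (suc m) μ +N xδN (suc m) (suc μ))

+N-embed : ∀ {p q p′ q′} → p ≗ embed p′ → q ≗ embed q′ → p +P q ≗ embed (p′ +N q′)
+N-embed {p′ = p′} {q′ = q′} e f k = trans (cong₂ _+_ (e k) (f k)) (sym (toℚ-+ (p′ k) (q′ k)))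

mulXN-embed : ∀ {p p′} → p ≗ embed p′ → mulX p ≗ embed (mulXN p′)
mulXN-embed e zero = refl
mulXN-embed e (suc k) = e k

monoN-embed : ∀ c d → monomial (toℚ c) d ≗ embed (monoN c d)
monoN-embed c d k = sym (if-float toℚ (k ℕ.≡ᵇ d))

DN-embed : ∀ {p p′} → p ≗ embed p′ → D p ≗ embed (DN p′)
DN-embed {p} {p′} e =
  +N-embed {p′ = mulXN (mulXN (derivN p′))} (mulXN-embed (mulXN-embed deriv-embed)) (mulXN-embed deriv-embed)
  where
  deriv-embed : deriv p ≗ embed (derivN p′)
  deriv-embed k = trans (cong (toℚ (suc k) *_) (e (suc k))) (sym (toℚ-* (suc k) (p′ (suc k))))

if-embed : ∀ b {p q p′ q′} → p ≗ embed p′ → q ≗ embed q′ →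
  (if b then p else q) ≗ embed (if b then p′ else q′)
if-embed true e f = e
if-embed false e f = f

lam-embed : ∀ n ν → lam n ν ≗ embed (lamN n ν)
lam-embed zero ν k = refl
lam-embed (suc zero) ν = if-embed (ν ℕ.≡ᵇ 1) (monoN-embed 1 0) (λ k → refl)
lam-embed (suc (suc m)) zero k = refl
lam-embed (suc (suc m)) (suc μ) =
  if-embed (suc (suc m) ℕ.≤ᵇ μ) (λ k → refl)
    (+N-embed {p′ = DN (lamN (suc m) (suc μ)) +N lamN (suc m) μ}
      (+N-embed {p′ = DN (lamN (suc m) (suc μ))} (DN-embed {p′ = lamN (suc m) (suc μ)} (lam-embed (suc m) (suc μ))) (lam-embed (suc m) μ))
      (if-embed (suc m ℕ.≡ᵇ suc μ) (mulXN-embed (monoN-embed 1 0)) (λ k → refl)))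

lamN-zero : ∀ n k → lamN n 0 k ≡ 0
lamN-zero zero k = refl
lamN-zero (suc zero) k = refl
lamN-zero (suc (suc n)) k = refl

lamN-above : ∀ n ν k → n < ν → lamN n ν k ≡ 0
lamN-above zero ν k _ = refl
lamN-above (suc zero) (suc zero) k (s≤s ())
lamN-above (suc zero) (suc (suc ν)) k _ = refl
lamN-above (suc (suc m)) (suc μ) k (s≤s n<μ) =
  cong (λ p → p k) (if-true {x = 0N} {y = DN (lamN (suc m) (suc μ)) +N lamN (suc m) μ +N xδN (suc m) (suc μ)}
    (≤ᵇ-≤ n<μ))

lamN-step : ∀ m μ k → μ ≤ suc m →
  lamN (suc (suc m)) (suc μ) k ≡ DN (lamN (suc m) (suc μ)) k ℕ.+ lamN (suc m) μ k ℕ.+ xδN (suc m) (suc μ) k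
lamN-step m μ k μ≤1+m =
  cong (λ p → p k) (if-false {x = 0N} {y = DN (lamN (suc m) (suc μ)) +N lamN (suc m) μ +N xδN (suc m) (suc μ)}
    (≤ᵇ-> (s≤s μ≤1+m)))

lam-zero : ∀ n → lam n 0 ≗ 0P
lam-zero n k = trans (lam-embed n 0 k) (cong toℚ (lamN-zero n k))

lam-above : ∀ n ν → n < ν → lam n ν ≗ 0P
lam-above n ν n<ν k = trans (lam-embed n ν k) (cong toℚ (lamN-above n ν k n<ν))

xδN-off : ∀ n ν → n ≢ ν → xδN n ν ≡ 0N
xδN-off n ν n≢ν rewrite ≡ᵇ-≢ n ν n≢ν = refl

xδN-on : ∀ n → xδN n n ≡ mulXN (monoN 1 0)
xδN-on n rewrite ≡ᵇ-refl n = refl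

Vanishes : PolyN → ℕ → Set
Vanishes p d = ∀ k → d < k → p k ≡ 0

DegreeN : PolyN → ℕ → Set
DegreeN p d = (p d ≢ 0) × Vanishes p d

xδN-vanishes : ∀ n ν → Vanishes (xδN n ν) 1
xδN-vanishes n ν (suc zero) (s≤s ())
xδN-vanishes n ν (suc (suc k)) _ with n ℕ.≡ᵇ ν
... | true = refl
... | false = refl

DN-suc : ∀ p j → DN p (suc j) ≡ j ℕ.* p j ℕ.+ suc j ℕ.* p (suc j)
DN-suc p zero = refl
DN-suc p (suc j) = refl

-- (x²+x) p′ = 0 for a constant p: j p_j = 0 since j = 0 or p_j = 0.
DN-constant : ∀ p → Vanishes p 0 → ∀ k → DN p k ≡ 0
DN-constant p p-const zero = refl
DN-constant p p-const (suc j) = trans (DN-suc p j) (cong₂ ℕ._+_ (scaled-vanishes j) (scaled-vanishes (suc j)))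
  where
  scaled-vanishes : ∀ j → j ℕ.* p j ≡ 0
  scaled-vanishes zero = refl
  scaled-vanishes (suc i) = trans (cong (suc i ℕ.*_) (p-const (suc i) (s≤s z≤n))) (NP.*-zeroʳ (suc i))

DN-vanishes : ∀ p d → Vanishes p d → Vanishes (DN p) (suc d)
DN-vanishes p d v (suc j) (s≤s d<j)
  rewrite DN-suc p j | v j d<j | v (suc j) (NP.m<n⇒m<1+n d<j) | NP.*-zeroʳ j = refl

DN-lead : ∀ p d → Vanishes p d → DN p (suc d) ≡ d ℕ.* p d
DN-lead p d v rewrite DN-suc p d | v (suc d) NP.≤-refl | NP.*-zeroʳ d = NP.+-identityʳ _

+-≢0ˡ : ∀ a b → a ≢ 0 → a ℕ.+ b ≢ 0
+-≢0ˡ a b a≢0 e = a≢0 (NP.m+n≡0⇒m≡0 a e)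

+-≢0ʳ : ∀ a b → b ≢ 0 → a ℕ.+ b ≢ 0
+-≢0ʳ a b b≢0 e = b≢0 (NP.m+n≡0⇒n≡0 a e)

*-≢0 : ∀ a b → a ≢ 0 → b ≢ 0 → a ℕ.* b ≢ 0
*-≢0 a b a≢0 b≢0 e with NP.m*n≡0⇒m≡0∨n≡0 a e
... | inj₁ a≡0 = a≢0 a≡0
... | inj₂ b≡0 = b≢0 b≡0

-- Diagonal, sub-diagonal and degrees of λ

lamN-diagonal : ∀ m k → lamN (suc m) (suc m) k ≡ monoN 1 0 k
lamN-diagonal zero k = refl
lamN-diagonal (suc m) k = begin
    lamN (suc (suc m)) (suc (suc m)) k
  ≡⟨ lamN-step m (suc m) k NP.≤-refl ⟩
    DN (lamN (suc m) (suc (suc m))) k ℕ.+ lamN (suc m) (suc m) k ℕ.+ xδN (suc m) (suc (suc m)) k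
  ≡⟨ cong₂ (λ a b → a ℕ.+ b ℕ.+ xδN (suc m) (suc (suc m)) k)
       (DN-constant _ (λ j _ → lamN-above (suc m) (suc (suc m)) j NP.≤-refl) k) (lamN-diagonal m k) ⟩
    monoN 1 0 k ℕ.+ xδN (suc m) (suc (suc m)) k
  ≡⟨ cong (λ p → monoN 1 0 k ℕ.+ p k) (xδN-off (suc m) (suc (suc m)) (NP.<⇒≢ (NP.n<1+n (suc m)))) ⟩
    monoN 1 0 k ℕ.+ 0
  ≡⟨ NP.+-identityʳ _ ⟩
    monoN 1 0 k
  ∎
  where open ≡-Reasoning

lamN-subdiagonal : ∀ m k → lamN (suc m) m k ≡ monoN m 1 k
lamN-subdiagonal zero zero = refl
lamN-subdiagonal zero (suc zero) = refl
lamN-subdiagonal zero (suc (suc k)) = refl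
lamN-subdiagonal (suc m) k = begin
    lamN (suc (suc m)) (suc m) k
  ≡⟨ lamN-step m m k (NP.n≤1+n m) ⟩
    DN (lamN (suc m) (suc m)) k ℕ.+ lamN (suc m) m k ℕ.+ xδN (suc m) (suc m) k
  ≡⟨ cong₂ (λ a b → a ℕ.+ b ℕ.+ xδN (suc m) (suc m) k)
       (DN-constant (lamN (suc m) (suc m)) (λ { (suc j) _ → lamN-diagonal m (suc j) }) k) (lamN-subdiagonal m k) ⟩
    monoN m 1 k ℕ.+ xδN (suc m) (suc m) k
  ≡⟨ cong (λ p → monoN m 1 k ℕ.+ p k) (xδN-on (suc m)) ⟩
    monoN m 1 k ℕ.+ mulXN (monoN 1 0) k
  ≡⟨ add-x k ⟩
    monoN (suc m) 1 k
  ∎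
  where
  open ≡-Reasoning
  add-x : ∀ k → monoN m 1 k ℕ.+ mulXN (monoN 1 0) k ≡ monoN (suc m) 1 k
  add-x zero = refl
  add-x (suc zero) = NP.+-comm m 1
  add-x (suc (suc k)) = refl

Row : ℕ → Set
Row m = ∀ ν → 1 ≤ ν → ν ≤ suc m → DegreeN (lamN (suc m) ν) (suc m ∸ ν)

diagonal-degree : ∀ m → DegreeN (lamN (suc m) (suc m)) 0
diagonal-degree m = (λ e → NP.1+n≢0 (trans (sym (lamN-diagonal m 0)) e))
                  , (λ { (suc j) _ → lamN-diagonal m (suc j) })

row-vanishes : ∀ m → Row m → ∀ μ → μ ≤ suc m → Vanishes (lamN (suc m) μ) (suc m ∸ μ)
row-vanishes m row zero _ k _ = lamN-zero (suc m) k
row-vanishes m row (suc μ) μ<1+m = proj₂ (row (suc μ) (s≤s z≤n) μ<1+m)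

-- Below the diagonal each summand of the recursion vanishes above n - ν + 1 ...
step-vanishes : ∀ m μ → μ ≤ m → Row m → Vanishes (lamN (suc (suc m)) (suc μ)) (suc (m ∸ μ))
step-vanishes m μ μ≤m row k d<k
  rewrite lamN-step m μ k (NP.m≤n⇒m≤1+n μ≤m)
        | DN-vanishes _ (m ∸ μ) (proj₂ (row (suc μ) (s≤s z≤n) (s≤s μ≤m))) k d<k
        | row-vanishes m row μ (NP.m≤n⇒m≤1+n μ≤m) k (subst (_< k) (sym (NP.+-∸-assoc 1 μ≤m)) d<k)
        | xδN-vanishes (suc m) (suc μ) k (NP.≤-<-trans (s≤s z≤n) d<k) = refl

-- ... and the coefficient there is nonzero: it contains λ_{n,ν-1}'s leading
-- coefficient if ν ≥ 2, (n-1)·(leading coefficient of λ_{n,1}) if ν = 1 < n,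
-- and equals 1 for λ_{2,1} = x.
step-leading : ∀ m μ → μ ≤ m → Row m → lamN (suc (suc m)) (suc μ) (suc (m ∸ μ)) ≢ 0
step-leading zero zero _ _ = λ ()
step-leading (suc m) zero _ row rewrite lamN-step (suc m) 0 (suc (suc m)) z≤n =
  +-≢0ˡ _ _ (+-≢0ˡ _ _ (subst (_≢ 0) (sym (DN-lead _ (suc m) (proj₂ first)))
                                        (*-≢0 (suc m) _ (λ ()) (proj₁ first))))
  where
  first : DegreeN (lamN (suc (suc m)) 1) (suc m)
  first = row 1 (s≤s z≤n) (s≤s z≤n)
step-leading m (suc μ) μ<m row rewrite lamN-step m (suc μ) (suc (m ∸ suc μ)) (NP.m≤n⇒m≤1+n μ<m) =
  +-≢0ˡ _ (xδN (suc m) (suc (suc μ)) (suc d))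
    (+-≢0ʳ (DN (lamN (suc m) (suc (suc μ))) (suc d)) _
      (subst (λ e → lamN (suc m) (suc μ) e ≢ 0) (NP.+-∸-assoc 1 μ<m)
        (proj₁ (row (suc μ) (s≤s z≤n) (NP.m≤n⇒m≤1+n μ<m)))))
  where
  d = m ∸ suc μ

-- Every row has the claimed degrees, by induction on n: the diagonal is
-- constant, and below it the recursion raises the degree by one.
lamN-degree : ∀ m → Row m
lamN-degree m (suc μ) _ ν≤n with NP.m≤n⇒m<n∨m≡n ν≤n
lamN-degree m (suc μ) _ _ | inj₂ refl = subst (DegreeN (lamN (suc m) (suc m))) (sym (NP.n∸n≡0 m)) (diagonal-degree m)
lamN-degree zero (suc μ) _ _ | inj₁ (s≤s ())
lamN-degree (suc m) (suc μ) _ _ | inj₁ (s≤s (s≤s μ≤m)) =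
  subst (DegreeN (lamN (suc (suc m)) (suc μ))) (sym (NP.+-∸-assoc 1 μ≤m))
    (step-leading m μ μ≤m (lamN-degree m) , step-vanishes m μ μ≤m (lamN-degree m))

HasDegree-embed : ∀ {p q d} → p ≗ embed q → DegreeN q d → HasDegree p d
HasDegree-embed {d = d} e (leading , vanishing) =
    (λ p-d≡0 → leading (toℚ-injective-0 _ (trans (sym (e d)) p-d≡0)))
  , (λ k d<k → trans (e k) (cong toℚ (vanishing k d<k)))

-- The identity F̂_n = Σ_ν λ_{n,ν} F_ν

xδ-sum : ∀ N n → 1 ≤ n → n ≤ N → (f : ℕ → Poly) → sum1 N (λ ν → xδ n ν *P f ν) ≗ mulX (f n)
xδ-sum N n 1≤n n≤N f k = begin
    sum1 N (λ ν → xδ n ν *P f ν) k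
  ≡⟨ sum1-single N n {λ ν → xδ n ν *P f ν} k 1≤n n≤N off ⟩
    (xδ n n *P f n) k
  ≡⟨ cong (λ b → ((if b then mulX (monomial 1ℚ 0) else 0P) *P f n) k) (≡ᵇ-refl n) ⟩
    (mulX (monomial 1ℚ 0) *P f n) k
  ≡⟨ trans (*P-mulXˡ (monomial 1ℚ 0) (f n) k) (mulX-cong (*P-identityˡ (f n)) k) ⟩
    mulX (f n) k
  ∎
  where
  open ≡-Reasoning
  off : ∀ ν → ν ≢ n → (xδ n ν *P f ν) k ≡ 0ℚ
  off ν ν≢n = *P-zeroˡ (f ν) (λ j → cong (λ b → (if b then mulX (monomial 1ℚ 0) else 0P) j)
                                         (≡ᵇ-≢ n ν (λ e → ν≢n (sym e)))) k

G : ℕ → Poly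
G n = sum1 n (λ ν → lam n ν *P F ν)

-- With n = m+1, the recursion of λ splits
-- G_{n+1} into Σ_ν Dλ_{n,ν} F_ν + Σ_ν λ_{n,ν} F_{ν+1} + x F_n, and by the
-- Leibniz rule the first two sums together are L G_n.
G-rec : ∀ m → G (suc (suc m)) ≗ L (G (suc m)) +P mulX (F (suc m))
G-rec m = begin
    G (suc n)
  ≈⟨ sum1-cong (suc n) expand ⟩
    sum1 (suc n) (λ ν → (A ν +P B ν) +P C ν)
  ≈⟨ ≗-trans (sum1-+ (suc n) (λ ν → A ν +P B ν) C) (+P-cong (sum1-+ (suc n) A B) ≗-refl) ⟩
    (sum1 (suc n) A +P sum1 (suc n) B) +P sum1 (suc n) C
  ≈⟨ +P-cong (+P-cong drop-last drop-first) (xδ-sum (suc n) n (s≤s z≤n) (NP.n≤1+n n) F) ⟩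
    (sum1 n A +P sum1 n (λ ν → B (suc ν))) +P mulX (F n)
  ≈⟨ +P-cong (≗-sym L-G) ≗-refl ⟩
    L (G n) +P mulX (F n)
  ∎
  where
  open SetoidReasoning Poly-setoid
  n = suc m
  A B C : ℕ → Poly
  A ν = D (lam n ν) *P F ν
  B ν = lam n (ν ∸ 1) *P F ν
  C ν = xδ n ν *P F ν

  expand : ∀ ν → 1 ≤ ν → ν ≤ suc n → lam (suc n) ν *P F ν ≗ (A ν +P B ν) +P C ν
  expand (suc μ) _ (s≤s μ≤n) =
    ≗-trans (*P-cong (lam-step m μ μ≤n) ≗-refl)
      (≗-trans (*P-distribʳ _ _ (F (suc μ))) (+P-cong (*P-distribʳ (D (lam n (suc μ))) (lam n μ) (F (suc μ))) ≗-refl))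

  -- D λ_{n,n+1} = 0
  drop-last : sum1 (suc n) A ≗ sum1 n A
  drop-last k = trans (cong (sum1 n A k +_) (*P-zeroˡ (F (suc n)) (D-zero (lam-above n (suc n) NP.≤-refl)) k))
                      (QP.+-identityʳ _)

  -- λ_{n,0} = 0
  drop-first : sum1 (suc n) B ≗ sum1 n (λ ν → B (suc ν))
  drop-first k = trans (sum1-shift n B k)
    (trans (cong (_+ sum1 n (λ ν → B (suc ν)) k) (*P-zeroˡ (F 1) (lam-zero n) k)) (QP.+-identityˡ _))

  L-G : L (G n) ≗ sum1 n A +P sum1 n (λ ν → B (suc ν))
  L-G = ≗-trans (L-sum n (λ ν → lam n ν *P F ν))
          (≗-trans (sum1-cong n Leibniz) (sum1-+ n A (λ ν → B (suc ν))))
    where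
    Leibniz : ∀ ν → 1 ≤ ν → ν ≤ n → L (lam n ν *P F ν) ≗ A ν +P B (suc ν)
    Leibniz ν 1≤ν _ = ≗-trans (L-Leibniz (lam n ν) (F ν))
                        (+P-cong (≗-refl {A ν}) (*P-cong (≗-refl {lam n ν}) (≗-sym (F-rec ν 1≤ν))))

-- F̂_1 = F_1 = x since H_1 = 1 (by computation), and G_1 = λ_{1,1} F_1 = F_1.
Fhat≗G-base : Fhat 1 ≗ G 1
Fhat≗G-base k = sym (trans (QP.+-identityˡ _) (*P-identityˡ (F 1) k))

Fhat≗G : ∀ m → Fhat (suc m) ≗ G (suc m)
Fhat≗G zero = Fhat≗G-base
Fhat≗G (suc m) = ≗-trans (Fhat-rec (suc m) (s≤s z≤n))
  (≗-trans (+P-cong (L-cong (Fhat≗G m)) ≗-refl) (≗-sym (G-rec m)))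

proposition2p2 : ∀ (n : ℕ) → 1 ≤ n →
    (∀ k → Fhat n k ≡ sum1 n (λ ν → lam n ν *P F ν) k)
  × (∀ ν k → ∃ λ (m : ℕ) → lam n ν k ≡ toℚ m)
  × (∀ ν → 1 ≤ ν → ν ≤ n → HasDegree (lam n ν) (n ∸ ν))
  × (∀ k → lam n (n ∸ 1) k ≡ monomial (toℚ (n ∸ 1)) 1 k)
proposition2p2 (suc m) _ = Fhat≗G m , integral , degree , subdiagonal
  where
  integral : ∀ ν k → ∃ λ (c : ℕ) → lam (suc m) ν k ≡ toℚ c
  integral ν k = lamN (suc m) ν k , lam-embed (suc m) ν k

  degree : ∀ ν → 1 ≤ ν → ν ≤ suc m → HasDegree (lam (suc m) ν) (suc m ∸ ν)
  degree ν 1≤ν ν≤n = HasDegree-embed (lam-embed (suc m) ν) (lamN-degree m ν 1≤ν ν≤n)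

  subdiagonal : ∀ k → lam (suc m) m k ≡ monomial (toℚ m) 1 k
  subdiagonal k = trans (lam-embed (suc m) m k)
    (trans (cong toℚ (lamN-subdiagonal m k)) (sym (monoN-embed m 1 k)))
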